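{- For every integer $n\ge 1$, $N'(n,n,0)=N'(n,0,n)=N'(n,0,1)=1$.
   Context: $\mathbb{Z}_4$ is the ring of integers modulo $4$; a $\mathbb{Z}_4$-code of length $n$ is a $\mathbb{Z}_4$-submodule of $\mathbb{Z}_4^n$. A code has type $4^{k_1}2^{k_2}$ if it is isomorphic as an abelian group to $\mathbb{Z}_4^{k_1}\times\mathbb{Z}_2^{k_2}$. Two codes of the same length are equivalent if one is obtained from the other by permuting coordinates and changing signs of some coordinates. The trivial extension of a code $C$ of length $n-1$ is $\{(c,0)\mid c\in C\}$ (for $n-1=0$, the only code is the zero module). $N'(n,k_1,k_2)$ denotes the number of equivalence classes of $\mathbb{Z}_4$-codes of length $n$ and type $4^{k_1}2^{k_2}$ none of whose members is equivalent to the trivial extension of a $\mathbb{Z}_4$-code of length $n-1$. -}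

module Defs where

open import Level using (0ℓ)
open import Data.Nat using (ℕ; zero; suc; _+_; _∸_)
open import Data.Nat.DivMod using (_mod_)
open import Data.Fin using (Fin; toℕ)
open import Data.Fin.Permutation using (Permutation′; _⟨$⟩ʳ_)
open import Data.Bool using (Bool; if_then_else_)
open import Data.Vec using (Vec; []; _∷_; _∷ʳ_; replicate; zipWith; map; lookup; tabulate)
open import Data.Product using (Σ; ∃; _×_; _,_)
open import Relation.Binary.PropositionalEquality using (_≡_)
open import Relation.Unary using (Pred)
open import Relation.Nullary using (¬_)
open import Function.Bundles using (_⇔_)

Z4 : Set
Z4 = Fin 4

Z2 : Set
Z2 = Fin 2

0₄ : Z4
0₄ = Fin.zero

_+₄_ : Z4 → Z4 → Z4
a +₄ b = (toℕ a + toℕ b) mod 4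

_*₄_ : Z4 → Z4 → Z4
a *₄ b = (toℕ a Data.Nat.* toℕ b) mod 4

-₄_ : Z4 → Z4
-₄ a = (4 ∸ toℕ a) mod 4

_+₂_ : Z2 → Z2 → Z2
a +₂ b = (toℕ a + toℕ b) mod 2

Word : ℕ → Set
Word n = Vec Z4 n

_⊕_ : ∀ {n} → Word n → Word n → Word n
_⊕_ = zipWith _+₄_

_•_ : ∀ {n} → Z4 → Word n → Word n
a • w = map (a *₄_) w

Subset4 : ℕ → Set₁
Subset4 n = Pred (Word n) 0ℓ

record IsCode {n : ℕ} (C : Subset4 n) : Set where
  field
    zero-mem : C (replicate n 0₄)
    add-mem  : ∀ u v → C u → C v → C (u ⊕ v)
    smul-mem : ∀ a v → C v → C (a • v)

Grp : ℕ → ℕ → Set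
Grp k₁ k₂ = Vec Z4 k₁ × Vec Z2 k₂

_⊞_ : ∀ {k₁ k₂} → Grp k₁ k₂ → Grp k₁ k₂ → Grp k₁ k₂
(x , y) ⊞ (x' , y') = zipWith _+₄_ x x' , zipWith _+₂_ y y'

-- C has type 4^k₁ 2^k₂: there is a group isomorphism ℤ₄^k₁ × ℤ₂^k₂ ≅ C,
-- given as an injective additive map into ℤ₄ⁿ whose image is exactly C.
HasType : ∀ {n} → Subset4 n → ℕ → ℕ → Set
HasType {n} C k₁ k₂ =
  Σ (Grp k₁ k₂ → Word n) λ g →
    (∀ x y → g (x ⊞ y) ≡ g x ⊕ g y) ×
    (∀ x y → g x ≡ g y → x ≡ y) ×
    (∀ w → C w ⇔ (∃ λ x → g x ≡ w))

act : ∀ {n} → Permutation′ n → Vec Bool n → Word n → Word n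
act π s w = tabulate λ i →
  if lookup s i then -₄ lookup w (π ⟨$⟩ʳ i) else lookup w (π ⟨$⟩ʳ i)

Equivalent : ∀ {n} → Subset4 n → Subset4 n → Set
Equivalent {n} C D =
  Σ (Permutation′ n) λ π → Σ (Vec Bool n) λ s →
    ∀ v → D v ⇔ (∃ λ w → C w × act π s w ≡ v)

TrivExt : ∀ {m} → Subset4 m → Subset4 (suc m)
TrivExt {m} C v = ∃ λ c → C c × (c ∷ʳ 0₄) ≡ v

-- codes counted by N'(n,k₁,k₂) for n = suc m
Counted : (m k₁ k₂ : ℕ) → Subset4 (suc m) → Set₁
Counted m k₁ k₂ C =
  IsCode C × HasType C k₁ k₂ ×
  (¬ (Σ (Subset4 m) λ D → IsCode D × Equivalent C (TrivExt D)))

-- N'(suc m, k₁, k₂) = 1 : exactly one equivalence class of counted codes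
N'≡1 : (m k₁ k₂ : ℕ) → Set₁
N'≡1 m k₁ k₂ =
  Σ (Subset4 (suc m)) λ C → Counted m k₁ k₂ C ×
    (∀ D → Counted m k₁ k₂ D → Equivalent C D)

module Submission where

-- The representatives are the whole space ℤ₄ⁿ, the doubled space 2ℤ₄ⁿ and the
-- repetition code {0, 22…2}.
--
-- Each of the three cases then exhibits its representative and shows that every other
-- counted code is the same set: for types 4ⁿ and 2ⁿ by counting, for type 2¹ because a
-- zero coordinate of the nonzero codeword would make the code a trivial extension.

open import Defs
open import Data.Nat using (ℕ; suc)
open import Data.Product using (_×_)

open import Data.Nat using (zero; _^_)
open import Data.Nat.Properties using (1+n≰n)
open import Data.Fin using (Fin; fromℕ; combine; punchOut; funToFin; finToFun; _≟_)
open import Data.Fin.Patterns using (0F; 1F; 2F; 3F)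
open import Data.Fin.Properties using (any?; punchOut-injective; injective⇒≤; funToFin-finToFin; finToFun-funToFin)
open import Data.Fin.Permutation as Perm using (Permutation′; _⟨$⟩ʳ_; inverseˡ)
open import Data.Bool using (Bool; true; false; if_then_else_)
open import Data.Vec using (Vec; []; _∷_; _∷ʳ_; replicate; zipWith; map; lookup; tabulate; head)
open import Data.Vec.Properties using (lookup∘tabulate; tabulate∘lookup; tabulate-cong; lookup-zipWith; lookup-map; lookup-replicate; zipWith-replicate; map-replicate; map-∘; map-cong; map-∷ʳ; ∷-injective)
open import Data.Vec.Relation.Binary.Pointwise.Extensional using (ext; Pointwise-≡⇒≡)
open import Data.Product using (Σ; ∃; _,_; proj₁; proj₂)
open import Data.Sum using (_⊎_; inj₁; inj₂)
open import Data.Unit using (tt)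
open import Function using (_∘_; id)
open import Function.Bundles using (_⇔_; mk⇔; _↔_; mk↔ₛ′; Inverse; Equivalence)
open import Relation.Binary.PropositionalEquality
open import Relation.Nullary using (¬_; yes; no; contradiction)
open import Relation.Unary using (U; _≐_)
open import Relation.Unary.Properties using (≐-trans)

lookup-ext : ∀ {A : Set} {n} {u v : Vec A n} → (∀ i → lookup u i ≡ lookup v i) → u ≡ v
lookup-ext = Pointwise-≡⇒≡ ∘ ext

-- Pigeonhole: an injective self-map of Fin k is onto.  A missed value y would make
-- x ↦ punchOut (f x ≢ y) an injection of Fin (k + 1) into Fin k.
Fin-injective⇒surjective : ∀ {k} (f : Fin k → Fin k) → (∀ x y → f x ≡ f y → x ≡ y) →
                           ∀ y → ∃ λ x → f x ≡ y
Fin-injective⇒surjective {zero} f _ ()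
Fin-injective⇒surjective {suc k} f inj y with any? (λ x → f x ≟ y)
... | yes hit = hit
... | no miss = contradiction (injective⇒≤ punched-injective) 1+n≰n
  where
    avoids : ∀ x → ¬ y ≡ f x
    avoids x y≡fx = miss (x , sym y≡fx)
    punched-injective : ∀ {x x′} → punchOut (avoids x) ≡ punchOut (avoids x′) → x ≡ x′
    punched-injective e = inj _ _ (punchOut-injective (avoids _) (avoids _) e)

funToFin-cong : ∀ {m n} {f g : Fin m → Fin n} → (∀ i → f i ≡ g i) → funToFin f ≡ funToFin g
funToFin-cong {zero} _ = refl
funToFin-cong {suc m} f≗g = cong₂ combine (f≗g 0F) (funToFin-cong (f≗g ∘ Data.Fin.suc))

Vec↔Fin^ : ∀ {a n} → Vec (Fin a) n ↔ Fin (a ^ n)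
Vec↔Fin^ {a} {n} = mk↔ₛ′ encode decode encode∘decode decode∘encode
  where
    encode : Vec (Fin a) n → Fin (a ^ n)
    encode v = funToFin (lookup v)
    decode : Fin (a ^ n) → Vec (Fin a) n
    decode k = tabulate (finToFun k)
    encode∘decode : ∀ k → encode (decode k) ≡ k
    encode∘decode k = trans (funToFin-cong {n} {a} (lookup∘tabulate (finToFun k))) (funToFin-finToFin {n} {a} k)
    decode∘encode : ∀ v → decode (encode v) ≡ v
    decode∘encode v = trans (tabulate-cong (finToFun-funToFin (lookup v))) (tabulate∘lookup v)

injective⇒surjective : ∀ {A : Set} {k} → A ↔ Fin k → (f : A → A) →
                       (∀ x y → f x ≡ f y → x ≡ y) → ∀ y → ∃ λ x → f x ≡ y
injective⇒surjective A↔Fin f inj y =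
  let (i , hit) = Fin-injective⇒surjective (to ∘ f ∘ from) f-on-Fin-injective (to y)
  in from i , to-injective hit
  where
    open Inverse A↔Fin
    to-injective : ∀ {x x′} → to x ≡ to x′ → x ≡ x′
    to-injective e = trans (sym (strictlyInverseʳ _)) (trans (cong from e) (strictlyInverseʳ _))
    from-injective : ∀ {i j} → from i ≡ from j → i ≡ j
    from-injective e = trans (sym (strictlyInverseˡ _)) (trans (cong to e) (strictlyInverseˡ _))
    f-on-Fin-injective : ∀ i j → to (f (from i)) ≡ to (f (from j)) → i ≡ j
    f-on-Fin-injective i j = from-injective ∘ inj _ _ ∘ to-injective

-- Arithmetic in ℤ₄, by exhaustion.  dbl identifies ℤ₂ with the subgroup 2ℤ₄ = {0, 2};
-- half inverts it on the 2-torsion elements, i.e. those with a + a = 0.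

dbl : Z2 → Z4
dbl 0F = 0F
dbl 1F = 2F

half : Z4 → Z2
half 0F = 0F
half 1F = 0F
half 2F = 1F
half 3F = 1F

dbl-half : ∀ a → a +₄ a ≡ 0₄ → dbl (half a) ≡ a
dbl-half 0F _ = refl
dbl-half 1F ()
dbl-half 2F _ = refl
dbl-half 3F ()

dbl-injective : ∀ b b′ → dbl b ≡ dbl b′ → b ≡ b′
dbl-injective 0F 0F _ = refl
dbl-injective 0F 1F ()
dbl-injective 1F 0F ()
dbl-injective 1F 1F _ = refl

dbl-+ : ∀ b b′ → dbl (b +₂ b′) ≡ dbl b +₄ dbl b′
dbl-+ 0F 0F = refl
dbl-+ 0F 1F = refl
dbl-+ 1F 0F = refl
dbl-+ 1F 1F = refl

-- 2ℤ₄ is an ideal: a multiple of a doubled element is again doubled.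
*-dbl : ∀ a b → a *₄ dbl b ≡ dbl (half (a *₄ dbl b))
*-dbl 0F 0F = refl
*-dbl 1F 0F = refl
*-dbl 2F 0F = refl
*-dbl 3F 0F = refl
*-dbl 0F 1F = refl
*-dbl 1F 1F = refl
*-dbl 2F 1F = refl
*-dbl 3F 1F = refl

torsion-0-or-2 : ∀ a → a +₄ a ≡ 0₄ → a ≡ 0₄ ⊎ a ≡ 2F
torsion-0-or-2 0F _ = inj₁ refl
torsion-0-or-2 1F ()
torsion-0-or-2 2F _ = inj₂ refl
torsion-0-or-2 3F ()

+-idempotent⇒0 : ∀ a → a +₄ a ≡ a → a ≡ 0₄
+-idempotent⇒0 0F _ = refl
+-idempotent⇒0 1F ()
+-idempotent⇒0 2F ()
+-idempotent⇒0 3F ()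

-- Scalars fix the zero entry, so extending by 0 commutes with scalars.
*-zeroʳ : ∀ a → a *₄ 0₄ ≡ 0₄
*-zeroʳ 0F = refl
*-zeroʳ 1F = refl
*-zeroʳ 2F = refl
*-zeroʳ 3F = refl

+₂-self : ∀ b → b +₂ b ≡ 0F
+₂-self 0F = refl
+₂-self 1F = refl

signed : Bool → Z4 → Z4
signed s a = if s then -₄ a else a

signed-nonzero : ∀ s a → ¬ a ≡ 0₄ → ¬ signed s a ≡ 0₄
signed-nonzero false a a≢0 = a≢0
signed-nonzero true 0F a≢0 _ = a≢0 refl
signed-nonzero true 1F _ ()
signed-nonzero true 2F _ ()
signed-nonzero true 3F _ ()

map-zipWith-hom : ∀ {A B : Set} {n} (f : A → B) {_∙_ : A → A → A} {_∘′_ : B → B → B} →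
                  (∀ a b → f (a ∙ b) ≡ f a ∘′ f b) →
                  ∀ (u v : Vec A n) → map f (zipWith _∙_ u v) ≡ zipWith _∘′_ (map f u) (map f v)
map-zipWith-hom f hom [] [] = refl
map-zipWith-hom f hom (x ∷ u) (y ∷ v) = cong₂ _∷_ (hom x y) (map-zipWith-hom f hom u v)

map-injective : ∀ {A B : Set} {n} (f : A → B) → (∀ a b → f a ≡ f b → a ≡ b) →
                ∀ (u v : Vec A n) → map f u ≡ map f v → u ≡ v
map-injective f inj [] [] _ = refl
map-injective f inj (x ∷ u) (y ∷ v) e =
  let (x≡y , u≡v) = ∷-injective e in cong₂ _∷_ (inj x y x≡y) (map-injective f inj u v u≡v)

zipWith-self : ∀ {A B : Set} {n} {_∙_ : A → A → B} {e : B} → (∀ a → a ∙ a ≡ e) →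
               ∀ (u : Vec A n) → zipWith _∙_ u u ≡ replicate n e
zipWith-self self [] = refl
zipWith-self self (x ∷ u) = cong₂ _∷_ (self x) (zipWith-self self u)

zipWith-∷ʳ : ∀ {A B C : Set} {n} (f : A → B → C) (u : Vec A n) (v : Vec B n) x y →
             zipWith f (u ∷ʳ x) (v ∷ʳ y) ≡ zipWith f u v ∷ʳ f x y
zipWith-∷ʳ f [] [] x y = refl
zipWith-∷ʳ f (a ∷ u) (b ∷ v) x y = cong (f a b ∷_) (zipWith-∷ʳ f u v x y)

replicate-∷ʳ : ∀ {A : Set} m (x : A) → replicate m x ∷ʳ x ≡ replicate (suc m) x
replicate-∷ʳ zero x = refl
replicate-∷ʳ (suc m) x = cong (x ∷_) (replicate-∷ʳ m x)

lookup-last : ∀ {A : Set} {m} (c : Vec A m) x → lookup (c ∷ʳ x) (fromℕ m) ≡ x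
lookup-last [] x = refl
lookup-last (y ∷ c) x = lookup-last c x

split-last : ∀ {A : Set} {m} (v : Vec A (suc m)) → ∃ λ c → c ∷ʳ lookup v (fromℕ m) ≡ v
split-last {m = zero} (x ∷ []) = [] , refl
split-last {m = suc m} (x ∷ v) = let (c , c∷ʳlast≡v) = split-last v in x ∷ c , cong (x ∷_) c∷ʳlast≡v

permute : ∀ {A : Set} {n} → Permutation′ n → Vec A n → Vec A n
permute π w = tabulate λ i → lookup w (π ⟨$⟩ʳ i)

lookup-permute : ∀ {A : Set} {n} π (w : Vec A n) i → lookup (permute π w) i ≡ lookup w (π ⟨$⟩ʳ i)
lookup-permute π w = lookup∘tabulate (λ i → lookup w (π ⟨$⟩ʳ i))

permute-flip : ∀ {A : Set} {n} π (w : Vec A n) → permute π (permute (Perm.flip π) w) ≡ w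
permute-flip π w = lookup-ext λ i →
  trans (lookup-permute π (permute (Perm.flip π) w) i)
    (trans (lookup-permute (Perm.flip π) w (π ⟨$⟩ʳ i)) (cong (lookup w) (inverseˡ π)))

permute-zipWith : ∀ {A B C : Set} {n} π (f : A → B → C) (u : Vec A n) v →
                  permute π (zipWith f u v) ≡ zipWith f (permute π u) (permute π v)
permute-zipWith π f u v = lookup-ext λ i → begin
  lookup (permute π (zipWith f u v)) i                  ≡⟨ lookup-permute π (zipWith f u v) i ⟩
  lookup (zipWith f u v) (π ⟨$⟩ʳ i)                     ≡⟨ lookup-zipWith f (π ⟨$⟩ʳ i) u v ⟩
  f (lookup u (π ⟨$⟩ʳ i)) (lookup v (π ⟨$⟩ʳ i))         ≡⟨ sym (cong₂ f (lookup-permute π u i) (lookup-permute π v i)) ⟩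
  f (lookup (permute π u) i) (lookup (permute π v) i)   ≡⟨ sym (lookup-zipWith f i (permute π u) (permute π v)) ⟩
  lookup (zipWith f (permute π u) (permute π v)) i      ∎
  where open ≡-Reasoning

permute-map : ∀ {A B : Set} {n} π (f : A → B) (u : Vec A n) → permute π (map f u) ≡ map f (permute π u)
permute-map π f u = lookup-ext λ i →
  trans (lookup-permute π (map f u) i)
    (trans (lookup-map (π ⟨$⟩ʳ i) f u) (sym (trans (lookup-map i f (permute π u)) (cong f (lookup-permute π u i)))))

permute-replicate : ∀ {A : Set} {n} π (x : A) → permute π (replicate n x) ≡ replicate n x
permute-replicate {n = n} π x = lookup-ext λ i →
  trans (lookup-permute π (replicate n x) i) (trans (lookup-replicate (π ⟨$⟩ʳ i) x) (sym (lookup-replicate i x)))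

record IsLinear {m n} (L : Word m → Word n) : Set where
  field
    preserves-0 : L (replicate m 0₄) ≡ replicate n 0₄
    preserves-⊕ : ∀ u v → L (u ⊕ v) ≡ L u ⊕ L v
    preserves-• : ∀ a u → L (a • u) ≡ a • L u

preimage-isCode : ∀ {m n} {L : Word m → Word n} {C : Subset4 n} → IsLinear L → IsCode C → IsCode (C ∘ L)
preimage-isCode {C = C} linear code = record
  { zero-mem = subst C (sym preserves-0) zero-mem
  ; add-mem  = λ u v Cu Cv → subst C (sym (preserves-⊕ u v)) (add-mem _ _ Cu Cv)
  ; smul-mem = λ a u Cu → subst C (sym (preserves-• a u)) (smul-mem a _ Cu)
  }
  where
    open IsLinear linear
    open IsCode code

∘-isLinear : ∀ {l m n} {L : Word m → Word n} {K : Word l → Word m} → IsLinear L → IsLinear K → IsLinear (L ∘ K)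
∘-isLinear {L = L} L-linear K-linear = record
  { preserves-0 = trans (cong L K.preserves-0) L.preserves-0
  ; preserves-⊕ = λ u v → trans (cong L (K.preserves-⊕ u v)) (L.preserves-⊕ _ _)
  ; preserves-• = λ a u → trans (cong L (K.preserves-• a u)) (L.preserves-• a _)
  }
  where
    module L = IsLinear L-linear
    module K = IsLinear K-linear

permute-isLinear : ∀ {n} (π : Permutation′ n) → IsLinear (permute π)
permute-isLinear π = record
  { preserves-0 = permute-replicate π 0₄
  ; preserves-⊕ = permute-zipWith π _+₄_
  ; preserves-• = λ a → permute-map π (a *₄_)
  }

extend-isLinear : ∀ {m} → IsLinear {m} (_∷ʳ 0₄)
extend-isLinear {m} = record
  { preserves-0 = replicate-∷ʳ m 0₄
  ; preserves-⊕ = λ u v → sym (zipWith-∷ʳ _+₄_ u v 0₄ 0₄)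
  ; preserves-• = λ a u → sym (trans (map-∷ʳ (a *₄_) 0₄ u) (cong (a • u ∷ʳ_) (*-zeroʳ a)))
  }

act-unsigned : ∀ {n} π (w : Word n) → act π (replicate n false) w ≡ permute π w
act-unsigned π w = tabulate-cong λ i → cong (λ s → signed s (lookup w (π ⟨$⟩ʳ i))) (lookup-replicate i false)

permutation-equivalent : ∀ {n} {C D : Subset4 n} (π : Permutation′ n) →
                         (∀ v → D v ⇔ C (permute (Perm.flip π) v)) → Equivalent C D
permutation-equivalent {C = C} π D⇔C = π , replicate _ false , λ v → mk⇔
  (λ Dv → permute (Perm.flip π) v , Equivalence.to (D⇔C v) Dv ,
          trans (act-unsigned π (permute (Perm.flip π) v)) (permute-flip π v))
  (λ { (w , Cw , πw≡v) → Equivalence.from (D⇔C v)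
         (subst C (trans (sym (permute-flip (Perm.flip π) w))
                         (cong (permute (Perm.flip π)) (trans (sym (act-unsigned π w)) πw≡v))) Cw) })

≐⇒equivalent : ∀ {n} {C D : Subset4 n} → D ≐ C → Equivalent C D
≐⇒equivalent {C = C} (D⊆C , C⊆D) = permutation-equivalent Perm.id λ v → mk⇔
  (λ Dv → subst C (sym (tabulate∘lookup v)) (D⊆C Dv))
  (λ Cv → C⊆D (subst C (tabulate∘lookup v) Cv))

NotTrivialExtension : ∀ {m} → Subset4 (suc m) → Set₁
NotTrivialExtension {m} C = ¬ (Σ (Subset4 m) λ D → IsCode D × Equivalent C (TrivExt D))

lookup-act : ∀ {n} π s (w : Word n) i → lookup (act π s w) i ≡ signed (lookup s i) (lookup w (π ⟨$⟩ʳ i))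
lookup-act π s w = lookup∘tabulate _

-- Monomial transformations map a constant word with nonzero entry a to a word with
-- entries ±a, which never has a zero last coordinate.
constant⇒not-trivial-extension : ∀ {m} {C : Subset4 (suc m)} a → ¬ a ≡ 0₄ →
                                 C (replicate (suc m) a) → NotTrivialExtension C
constant⇒not-trivial-extension {m} a a≢0 Ca (D , _ , π , s , C≈TrivExt)
  with Equivalence.from (C≈TrivExt (act π s (replicate (suc m) a))) (_ , Ca , refl)
... | c , _ , c∷ʳ0≡v = signed-nonzero (lookup s (fromℕ m)) a a≢0 (begin
  signed (lookup s (fromℕ m)) a                     ≡⟨ cong (signed (lookup s (fromℕ m)))
                                                           (sym (lookup-replicate (π ⟨$⟩ʳ fromℕ m) a)) ⟩
  signed (lookup s (fromℕ m)) (lookup (replicate (suc m) a) (π ⟨$⟩ʳ fromℕ m))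
                                                    ≡⟨ sym (lookup-act π s (replicate (suc m) a) (fromℕ m)) ⟩
  lookup (act π s (replicate (suc m) a)) (fromℕ m)  ≡⟨ cong (λ v → lookup v (fromℕ m)) (sym c∷ʳ0≡v) ⟩
  lookup (c ∷ʳ 0₄) (fromℕ m)                        ≡⟨ lookup-last c 0₄ ⟩
  0₄                                                ∎)
  where open ≡-Reasoning

transpose-last : ∀ {m} (j : Fin (suc m)) → Perm.transpose (fromℕ m) j ⟨$⟩ʳ fromℕ m ≡ j
transpose-last {m} j with fromℕ m ≟ fromℕ m
... | yes _ = refl
... | no last≢last = contradiction refl last≢last

-- A code vanishing at coordinate j is equivalent, by swapping j with the last
-- coordinate, to the trivial extension of its preimage under c ↦ (c, 0) ∘ swap.
vanishing⇒trivial-extension : ∀ {m} {D : Subset4 (suc m)} → IsCode D → (j : Fin (suc m)) →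
                              (∀ v → D v → lookup v j ≡ 0₄) →
                              Σ (Subset4 m) λ D′ → IsCode D′ × Equivalent D (TrivExt D′)
vanishing⇒trivial-extension {m} {D} code j vanishes =
  D ∘ swap-extend , preimage-isCode (∘-isLinear (permute-isLinear τ⁻¹) extend-isLinear) code ,
  permutation-equivalent τ (λ v → mk⇔ (λ { (c , Dc , refl) → Dc }) (extension v))
  where
    τ τ⁻¹ : Permutation′ (suc m)
    τ = Perm.transpose (fromℕ m) j
    τ⁻¹ = Perm.flip τ
    swap-extend : Word m → Word (suc m)
    swap-extend c = permute τ⁻¹ (c ∷ʳ 0₄)
    last-vanishes : ∀ v → D (permute τ⁻¹ v) → lookup v (fromℕ m) ≡ 0₄
    last-vanishes v Dv = begin
      lookup v (fromℕ m)                    ≡⟨ cong (lookup v) (sym (inverseˡ τ)) ⟩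
      lookup v (τ⁻¹ ⟨$⟩ʳ (τ ⟨$⟩ʳ fromℕ m))  ≡⟨ sym (lookup-permute τ⁻¹ v (τ ⟨$⟩ʳ fromℕ m)) ⟩
      lookup (permute τ⁻¹ v) (τ ⟨$⟩ʳ fromℕ m) ≡⟨ cong (lookup (permute τ⁻¹ v)) (transpose-last j) ⟩
      lookup (permute τ⁻¹ v) j              ≡⟨ vanishes _ Dv ⟩
      0₄                                    ∎
      where open ≡-Reasoning
    extension : ∀ v → D (permute τ⁻¹ v) → TrivExt (D ∘ swap-extend) v
    extension v Dv =
      let (c , c∷ʳlast≡v) = split-last v
          c∷ʳ0≡v = trans (cong (c ∷ʳ_) (sym (last-vanishes v Dv))) c∷ʳlast≡v
      in c , subst (D ∘ permute τ⁻¹) (sym c∷ʳ0≡v) Dv , c∷ʳ0≡v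

Additive : ∀ {n k₁ k₂} → (Grp k₁ k₂ → Word n) → Set
Additive g = ∀ x y → g (x ⊞ y) ≡ g x ⊕ g y

0ᴳ : ∀ {k₁ k₂} → Grp k₁ k₂
0ᴳ {k₁} {k₂} = replicate k₁ 0₄ , replicate k₂ 0F

-- An additive map sends 0 to 0, since 0 is the only idempotent of ℤ₄.
additive-zero : ∀ {n k₁ k₂} (g : Grp k₁ k₂ → Word n) → Additive g → g 0ᴳ ≡ replicate n 0₄
additive-zero {k₁ = k₁} {k₂} g additive = lookup-ext λ i →
  trans (+-idempotent⇒0 _ (begin
    lookup (g 0ᴳ) i +₄ lookup (g 0ᴳ) i ≡⟨ sym (lookup-zipWith _+₄_ i (g 0ᴳ) (g 0ᴳ)) ⟩
    lookup (g 0ᴳ ⊕ g 0ᴳ) i            ≡⟨ cong (λ w → lookup w i) (sym (additive 0ᴳ 0ᴳ)) ⟩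
    lookup (g (0ᴳ ⊞ 0ᴳ)) i            ≡⟨ cong (λ x → lookup (g x) i) 0+0≡0 ⟩
    lookup (g 0ᴳ) i                   ∎))
  (sym (lookup-replicate i 0₄))
  where
    open ≡-Reasoning
    0+0≡0 : 0ᴳ ⊞ 0ᴳ ≡ 0ᴳ {k₁} {k₂}
    0+0≡0 = cong₂ _,_ (zipWith-replicate _+₄_ 0₄ 0₄) (zipWith-replicate _+₂_ 0F 0F)

Torsion : ∀ {n} → Word n → Set
Torsion {n} w = w ⊕ w ≡ replicate n 0₄

torsion-at : ∀ {n} {w : Word n} → Torsion w → ∀ i → lookup w i +₄ lookup w i ≡ 0₄
torsion-at {w = w} w+w≡0 i =
  trans (sym (lookup-zipWith _+₄_ i w w)) (trans (cong (λ u → lookup u i) w+w≡0) (lookup-replicate i 0₄))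

-- Every element of ℤ₂^k has order 2, hence so does every value of an additive map on it.
additive-torsion : ∀ {n k} (g : Grp 0 k → Word n) → Additive g → ∀ x → Torsion (g x)
additive-torsion g additive ([] , y) =
  trans (sym (additive _ _))
    (trans (cong (λ y′ → g ([] , y′)) (zipWith-self +₂-self y)) (additive-zero g additive))

twice : ∀ {n} → Vec Z2 n → Word n
twice = map dbl

halve : ∀ {n} → Word n → Vec Z2 n
halve = map half

twice-halve : ∀ {n} {w : Word n} → Torsion w → twice (halve w) ≡ w
twice-halve {w = w} w-torsion = lookup-ext λ i →
  trans (lookup-map i dbl (halve w))
    (trans (cong dbl (lookup-map i half w)) (dbl-half _ (torsion-at w-torsion i)))

Image : ∀ {A : Set} {n} → (A → Word n) → Subset4 n
Image g w = ∃ λ x → g x ≡ w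

image-cong : ∀ {A : Set} {n} {g g′ : A → Word n} → (∀ x → g x ≡ g′ x) → Image g ≐ Image g′
image-cong g≗g′ = (λ { (x , refl) → x , sym (g≗g′ x) }) , (λ { (x , refl) → x , g≗g′ x })

image-hasType : ∀ {n k₁ k₂} (g : Grp k₁ k₂ → Word n) → Additive g →
                (∀ x y → g x ≡ g y → x ≡ y) → HasType (Image g) k₁ k₂
image-hasType g additive injective = g , additive , injective , λ w → mk⇔ id id

image-isCode : ∀ {n k₁ k₂} (g : Grp k₁ k₂ → Word n) → Additive g →
               (∀ a x → Image g (a • g x)) → IsCode (Image g)
image-isCode g additive scalar = record
  { zero-mem = 0ᴳ , additive-zero g additive
  ; add-mem  = λ { _ _ (x , refl) (y , refl) → x ⊞ y , additive x y }
  ; smul-mem = λ { a _ (x , refl) → scalar a x }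
  }

type-image : ∀ {n k₁ k₂} {C : Subset4 n} (type : HasType C k₁ k₂) → C ≐ Image (proj₁ type)
type-image (_ , _ , _ , C⇔image) = (λ {w} → Equivalence.to (C⇔image w)) , (λ {w} → Equivalence.from (C⇔image w))

N'≡1-by-classification : ∀ {m k₁ k₂} (C : Subset4 (suc m)) → Counted m k₁ k₂ C →
                         (∀ D → Counted m k₁ k₂ D → D ≐ C) → N'≡1 m k₁ k₂
N'≡1-by-classification C C-counted classify = C , C-counted , λ D D-counted → ≐⇒equivalent (classify D D-counted)

U-isCode : ∀ {n} → IsCode {n} U
U-isCode = record { zero-mem = tt ; add-mem = λ _ _ _ _ → tt ; smul-mem = λ _ _ _ → tt }

U-hasType : ∀ {n} → HasType {n} U n 0
U-hasType = proj₁ , (λ _ _ → refl) , (λ { (x , []) (y , []) x≡y → cong (_, []) x≡y }) ,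
            λ w → mk⇔ (λ _ → (w , []) , refl) (λ _ → tt)

-- A code of type 4ⁿ is the image of an injective self-map of ℤ₄ⁿ, hence all of ℤ₄ⁿ.
type-4ⁿ⇒everything : ∀ {n} {D : Subset4 n} → HasType D n 0 → D ≐ U
type-4ⁿ⇒everything (g , _ , injective , D⇔image) = (λ _ → tt) , λ {w} _ →
  let (x , gx≡w) = injective⇒surjective Vec↔Fin^ (λ x → g (x , []))
                     (λ x y e → cong proj₁ (injective _ _ e)) w
  in Equivalence.from (D⇔image w) ((x , []) , gx≡w)

-- ℤ₄ⁿ contains 22…2, so it is not a trivial extension.
case-4ⁿ : ∀ m → N'≡1 m (suc m) 0
case-4ⁿ m = N'≡1-by-classification U
  (U-isCode , U-hasType , constant⇒not-trivial-extension 2F (λ ()) tt)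
  (λ { D (_ , type , _) → type-4ⁿ⇒everything type })

doubling : ∀ {n} → Grp 0 n → Word n
doubling (_ , y) = twice y

doubling-additive : ∀ {n} → Additive (doubling {n})
doubling-additive (_ , y) (_ , y′) = map-zipWith-hom dbl dbl-+ y y′

doubling-injective : ∀ {n} (x y : Grp 0 n) → doubling x ≡ doubling y → x ≡ y
doubling-injective ([] , y) ([] , y′) 2y≡2y′ = cong ([] ,_) (map-injective dbl dbl-injective y y′ 2y≡2y′)

doubling-scalar : ∀ {n} a (x : Grp 0 n) → Image doubling (a • doubling x)
doubling-scalar a ([] , y) = ([] , map (half ∘ (a *₄_) ∘ dbl) y) , (begin
  twice (map (half ∘ (a *₄_) ∘ dbl) y)  ≡⟨ sym (map-∘ dbl (half ∘ (a *₄_) ∘ dbl) y) ⟩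
  map (dbl ∘ half ∘ (a *₄_) ∘ dbl) y    ≡⟨ sym (map-cong (*-dbl a) y) ⟩
  map ((a *₄_) ∘ dbl) y                 ≡⟨ map-∘ (a *₄_) dbl y ⟩
  a • twice y                           ∎)
  where open ≡-Reasoning

-- An injective additive g on ℤ₂ⁿ takes 2-torsion values, so g = twice ∘ h for the
-- injective, hence bijective, h = halve ∘ g; thus g and doubling have the same image.
type-2ⁿ⇒doubled : ∀ {n} {D : Subset4 n} → HasType D 0 n → D ≐ Image doubling
type-2ⁿ⇒doubled type@(g , additive , injective , _) = ≐-trans (type-image type) (into , onto)
  where
    g-doubled : ∀ x → twice (halve (g x)) ≡ g x
    g-doubled x = twice-halve (additive-torsion g additive x)
    into : ∀ {w} → Image g w → Image doubling w
    into (x , refl) = ([] , halve (g x)) , g-doubled x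
    h : Vec Z2 _ → Vec Z2 _
    h y = halve (g ([] , y))
    h-injective : ∀ y y′ → h y ≡ h y′ → y ≡ y′
    h-injective y y′ hy≡hy′ = cong proj₂ (injective _ _
      (trans (sym (g-doubled _)) (trans (cong twice hy≡hy′) (g-doubled _))))
    onto : ∀ {w} → Image doubling w → Image g w
    onto (([] , y₀) , refl) =
      let (y , hy≡y₀) = injective⇒surjective Vec↔Fin^ h h-injective y₀
      in ([] , y) , trans (sym (g-doubled _)) (cong twice hy≡y₀)

-- 2ℤ₄ⁿ contains 22…2 = 2·(1, …, 1), so it is not a trivial extension.
case-2ⁿ : ∀ m → N'≡1 m 0 (suc m)
case-2ⁿ m = N'≡1-by-classification (Image doubling)
  ( image-isCode doubling doubling-additive doubling-scalar
  , image-hasType doubling doubling-additive doubling-injective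
  , constant⇒not-trivial-extension 2F (λ ()) (([] , replicate (suc m) 1F) , map-replicate dbl 1F (suc m)))
  (λ { D (_ , type , _) → type-2ⁿ⇒doubled type })

repetition : ∀ {n} → Grp 0 1 → Word n
repetition {n} (_ , b ∷ []) = replicate n (dbl b)

-- repetition is additive and, for length n ≥ 1, injective; its image is closed
-- under scalars since 2ℤ₄ is an ideal.
repetition-additive : ∀ {n} → Additive (repetition {n})
repetition-additive {n} (_ , b ∷ []) (_ , b′ ∷ []) =
  trans (cong (replicate n) (dbl-+ b b′)) (sym (zipWith-replicate _+₄_ (dbl b) (dbl b′)))

repetition-injective : ∀ {m} (x y : Grp 0 1) → repetition {suc m} x ≡ repetition y → x ≡ y
repetition-injective ([] , b ∷ []) ([] , b′ ∷ []) e = cong (λ c → [] , c ∷ []) (dbl-injective b b′ (cong head e))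

repetition-scalar : ∀ {n} a (x : Grp 0 1) → Image (repetition {n}) (a • repetition x)
repetition-scalar {n} a ([] , b ∷ []) = ([] , half (a *₄ dbl b) ∷ []) ,
  trans (cong (replicate n) (sym (*-dbl a b))) (sym (map-replicate (a *₄_) (dbl b) n))

-- For a code of type 2¹ with nonzero element w = g(1): w is 2-torsion, and a zero
-- entry of w would be a coordinate where the whole code {0, w} vanishes, making it a
-- trivial extension.  Hence w = 22…2 and g agrees with repetition.
type-2⇒repetition : ∀ {m} {D : Subset4 (suc m)} → IsCode D → HasType D 0 1 →
                    NotTrivialExtension D → D ≐ Image repetition
type-2⇒repetition {D = D} code type@(g , additive , _ , _) not-trivial =
  ≐-trans (type-image type) (image-cong g≗repetition)
  where
    w : Word _
    w = g ([] , 1F ∷ [])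
    D-vanishes-where-w-does : ∀ j → lookup w j ≡ 0₄ → ∀ v → D v → lookup v j ≡ 0₄
    D-vanishes-where-w-does j wⱼ≡0 v Dv with proj₁ (type-image type) Dv
    ... | ([] , 0F ∷ []) , refl = trans (cong (λ u → lookup u j) (additive-zero g additive)) (lookup-replicate j 0₄)
    ... | ([] , 1F ∷ []) , refl = wⱼ≡0
    w-entry : ∀ j → lookup w j ≡ 2F
    w-entry j with torsion-0-or-2 _ (torsion-at (additive-torsion g additive ([] , 1F ∷ [])) j)
    ... | inj₂ wⱼ≡2 = wⱼ≡2
    ... | inj₁ wⱼ≡0 = contradiction (vanishing⇒trivial-extension code j (D-vanishes-where-w-does j wⱼ≡0)) not-trivial
    g≗repetition : ∀ x → g x ≡ repetition x
    g≗repetition ([] , 0F ∷ []) = additive-zero g additive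
    g≗repetition ([] , 1F ∷ []) = lookup-ext λ j → trans (w-entry j) (sym (lookup-replicate j 2F))

-- The repetition code contains 22…2, so it is not a trivial extension.
case-2¹ : ∀ m → N'≡1 m 0 1
case-2¹ m = N'≡1-by-classification (Image repetition)
  ( image-isCode repetition repetition-additive repetition-scalar
  , image-hasType repetition repetition-additive repetition-injective
  , constant⇒not-trivial-extension 2F (λ ()) (([] , 1F ∷ []) , refl))
  (λ { D (code , type , not-trivial) → type-2⇒repetition code type not-trivial })

proposition4p1 : ∀ (m : ℕ) → N'≡1 m (suc m) 0 × N'≡1 m 0 (suc m) × N'≡1 m 0 1
proposition4p1 m = case-4ⁿ m , case-2ⁿ m , case-2¹ m
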